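{- For every $e\ge0$, $\mathcal{J}^{(e)}=\langle G_{\tilde\alpha}\,:\,\tilde\alpha\in\mathcal{G}^{(e)}\rangle$, the ideal of $\mathbb{Q}[[x_1,x_2,\ldots]]$ generated by the $G_{\tilde\alpha}$ with $\tilde\alpha$ reaching level $e$.
   Context: A standard composition is a finite sequence of positive integers; for a composition $\alpha=[\alpha_1,\ldots,\alpha_k]$ of $d$ let $D(\alpha)=\{\alpha_1,\ldots,\alpha_1+\cdots+\alpha_{k-1}\}$ and $F_\alpha(x_1,x_2,\ldots)=\sum x_{j_1}\cdots x_{j_d}$ over $j_1\le\cdots\le j_d$ with $j_i<j_{i+1}$ whenever $i\in D(\alpha)$ ($F$ of the empty composition is $1$). A generalized composition is a finite or infinite sequence of nonnegative integers with finite sum $d(\cdot)$; $\ell(\cdot)$ is the length of a finite one; juxtaposition denotes concatenation. Every infinite generalized composition can be written $\tilde\alpha=\tilde\nu\,0\,0\cdots$ with $\tilde\nu$ finite and either empty or with nonzero last part. A generalized composition $\tilde\alpha$ reaches level $e$ if it factors as $\tilde\alpha=\tilde\pi\tilde\rho$ with $\tilde\pi$ a finite nonempty initial segment satisfying $d(\tilde\pi)-\ell(\tilde\pi)\ge e$; $\mathcal{G}^{(e)}$ is the set of infinite generalized compositions reaching level $e$. $\mathcal{J}^{(e)}$ is the ideal of the formal power series ring $\mathbb{Q}[[x_1,x_2,\ldots]]$ generated by the $F_\alpha(x_1,x_2,\ldots)$ for standard compositions $\alpha$ reaching level $e$. The series $G_{\tilde\alpha}$ are defined recursively on $\ell(\tilde\nu)$: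 if $\tilde\nu=\nu$ has no zero parts, $G_{\tilde\alpha}=F_\nu(x_1,x_2,\ldots)$; otherwise write uniquely $\tilde\nu=\tilde\gamma\,0\,a\,\beta$ with $a>0$, $\beta$ a (possibly empty) standard composition and $\tilde\gamma$ a (possibly empty) generalized composition, put $k=\ell(\tilde\gamma)+1$ and define $G_{\tilde\alpha}=G_{\tilde\gamma\,a\,\beta\,0\,0\cdots}-x_k\,G_{\tilde\gamma\,(a-1)\,\beta\,0\,0\cdots}$. -}

module Defs where

open import Data.Nat using (ℕ; zero; suc; _∸_; _≤_; _<ᵇ_; _≡ᵇ_)
open import Data.Bool using (Bool; true; false; if_then_else_; _∧_)
open import Data.List using (List; []; _∷_; _++_; length; take; replicate; map; concatMap; upTo; foldr; drop)
open import Data.Bool.ListAction using (and)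
open import Data.Nat.ListAction using (sum)
open import Data.List.Properties using (≡-dec)
open import Data.Maybe using (Maybe; just; nothing)
open import Data.Product using (Σ; _×_; _,_; ∃)
open import Data.List.Relation.Unary.All using (All)
open import Data.Rational using (ℚ; 0ℚ; 1ℚ; _+_; _*_; _-_)
open import Relation.Binary.PropositionalEquality using (_≡_)
open import Relation.Nullary using (yes; no)
import Data.Nat as N

-- Monomials in x₁, x₂, … are exponent vectors: a list m = [m₁, m₂, …]
-- with m_i the exponent of x_i.  A list and the same list with trailing
-- zeros appended denote the same monomial; the canonical representative
-- has no trailing zeros (see `strip`).

strip : List ℕ → List ℕ
strip [] = []
strip (x ∷ xs) with strip xs
... | [] = if x ≡ᵇ 0 then [] else x ∷ []
... | y ∷ ys = x ∷ y ∷ ys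

-- Only values at canonical (stripped) exponent vectors are meaningful;
-- all operations and the equality below only read those values.
Series : Set
Series = List ℕ → ℚ

_≈_ : Series → Series → Set
f ≈ g = ∀ m → f (strip m) ≡ g (strip m)

zeroS : Series
zeroS _ = 0ℚ

_⊕_ : Series → Series → Series
(f ⊕ g) m = f m + g m

_⊖_ : Series → Series → Series
(f ⊖ g) m = f m - g m

below : List ℕ → List (List ℕ)
below [] = [] ∷ []
below (c ∷ m) = concatMap (λ i → map (i ∷_) (below m)) (upTo (suc c))

_⊝_ : List ℕ → List ℕ → List ℕ
[] ⊝ _ = []
(x ∷ xs) ⊝ [] = x ∷ xs
(x ∷ xs) ⊝ (y ∷ ys) = (x ∸ y) ∷ (xs ⊝ ys)

sumℚ : List ℚ → ℚ
sumℚ = foldr _+_ 0ℚ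

_⊗_ : Series → Series → Series
(f ⊗ g) m = sumℚ (map (λ a → f (strip a) * g (strip (m ⊝ a))) (below m))

-- the variable x_k (k ≥ 1): exponent vector (0,…,0,1) with 1 in position k
varX : ℕ → Series
varX k m with ≡-dec N._≟_ (strip m) (replicate (k ∸ 1) 0 ++ (1 ∷ []))
... | yes _ = 1ℚ
... | no _ = 0ℚ

-- the weakly increasing word j₁ ≤ … ≤ j_d of the monomial x_{j₁}⋯x_{j_d}
wordFrom : ℕ → List ℕ → List ℕ
wordFrom p [] = []
wordFrom p (c ∷ m) = replicate c p ++ wordFrom (suc p) m

word : List ℕ → List ℕ
word = wordFrom 1

descFrom : ℕ → List ℕ → List ℕ
descFrom acc [] = []
descFrom acc (a ∷ []) = []
descFrom acc (a ∷ b ∷ r) = (acc N.+ a) ∷ descFrom (acc N.+ a) (b ∷ r)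

D : List ℕ → List ℕ
D = descFrom 0

-- j_i < j_{i+1} (1-indexed positions i, i+1 in the word w)
strictAt : List ℕ → ℕ → Bool
strictAt w i with drop (i ∸ 1) w
... | a ∷ b ∷ _ = a <ᵇ b
... | _ = false

F : List ℕ → Series
F α m = if (length w ≡ᵇ sum α) ∧ and (map (strictAt w) (D α)) then 1ℚ else 0ℚ
  where w = word m

-- The series G for generalized compositions.
-- An infinite generalized composition ν̃ 0 0 ⋯ is represented by any finite
-- list L with strip L = ν̃ (trailing zeros of L are part of the zero tail).

splitLastZero : List ℕ → Maybe (List ℕ × List ℕ)
splitLastZero [] = nothing
splitLastZero (x ∷ xs) with splitLastZero xs
... | just (γ , r) = just (x ∷ γ , r)
... | nothing = if x ≡ᵇ 0 then just ([] , xs) else nothing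

-- recursion on ℓ(ν̃) with fuel; argument is always stripped and of
-- length ≤ fuel, so the fuel never runs out on a nonempty list
Gfuel : ℕ → List ℕ → Series
Gfuel zero ν = F ν
Gfuel (suc n) ν with splitLastZero ν
... | nothing = F ν
... | just (γ , []) = Gfuel n (strip γ)   -- unreachable for stripped ν
... | just (γ , a ∷ β) =
  Gfuel n (strip (γ ++ a ∷ β)) ⊖ (varX (length γ N.+ 1) ⊗ Gfuel n (strip (γ ++ (a ∸ 1) ∷ β)))

G : List ℕ → Series
G L = Gfuel (length L) (strip L)

-- Reaching level e: a nonempty finite initial segment π with
-- d(π) - ℓ(π) ≥ e, i.e. d(π) ≥ e + ℓ(π).

ReachesStd : ℕ → List ℕ → Set
ReachesStd e α = Σ ℕ λ n → (1 ≤ n) × (n ≤ length α) × (e N.+ n ≤ sum (take n α))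

-- infinite generalized composition L 0 0 ⋯: initial segments of any length
-- (the initial segment of length n is take n L padded with zeros)
ReachesInf : ℕ → List ℕ → Set
ReachesInf e L = Σ ℕ λ n → (1 ≤ n) × (e N.+ n ≤ sum (take n L))

StandardComposition : List ℕ → Set
StandardComposition α = All (λ a → 1 ≤ a) α

InIdeal : {I : Set} → (I → Set) → (I → Series) → Series → Set
InIdeal {I} P gen f =
  Σ (List (Series × Σ I P)) λ terms →
    f ≈ foldr (λ { (r , (i , _)) acc → (r ⊗ gen i) ⊕ acc }) zeroS terms

InJ : ℕ → Series → Set
InJ e = InIdeal (λ α → StandardComposition α × ReachesStd e α) F

InGIdeal : ℕ → Series → Set
InGIdeal e = InIdeal (ReachesInf e) G

module Submission where

-- Unfolding G_{γ̃ 0 a β} = G_{γ̃ a β} − x_k G_{γ̃ (a−1) β}, both compositions on the right still reach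
-- level e: merging the zero into a shortens every long enough initial segment by one part and lowers
-- its sum by at most one.  So, by induction on the number of zero parts, every G_α̃ with α̃ reaching
-- level e lies with all its multiples in J^(e), the recursion ending at a standard composition,
-- where G = F.  The algebra needed is that r · (x_k h) = (x_k r) · h, a reindexing of the Cauchy
-- product.  Conversely F_α = G_α for standard α.

open import Defs
open import Data.Nat as ℕ using (ℕ; zero; suc; _∸_; _≤_; _<_; z≤n; s≤s; _≤?_)
open import Data.Nat.Properties as ℕ using (+-suc; +-assoc; ≤-trans; ≤-refl; ≤-pred; +-monoʳ-≤; +-monoˡ-≤)
open import Data.Nat.ListAction using (sum)
open import Data.Bool using (Bool; true; false; if_then_else_)
open import Data.List using (List; []; _∷_; _++_; length; take; replicate; map; concatMap; applyUpTo; foldr)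
open import Data.List.Properties using (≡-dec; ∷-injective; take-all; take-[]; ++-identityʳ; length-++)
open import Data.List.Relation.Unary.All using ([]; _∷_)
open import Data.Maybe using (just; nothing)
open import Data.Product using (Σ; _×_; _,_; proj₁; proj₂)
open import Data.Rational using (ℚ; 0ℚ; 1ℚ; _+_; _*_; _-_; -_)
import Data.Rational.Properties as ℚ
open import Data.Empty using (⊥-elim)
open import Function using (_∘_)
open import Relation.Binary.PropositionalEquality
open import Relation.Nullary using (¬_; yes; no)

open import Algebra.Bundles using (CommutativeMonoid)
open import Algebra.Properties.CommutativeSemigroup (CommutativeMonoid.commutativeSemigroup ℚ.+-0-commutativeMonoid)
  using (interchange)

infixr 5 _∷ˢ_

_∷ˢ_ : ℕ → List ℕ → List ℕ
x ∷ˢ y ∷ ys = x ∷ y ∷ ys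
zero ∷ˢ [] = []
suc x ∷ˢ [] = suc x ∷ []

strip-∷ : ∀ x xs → strip (x ∷ xs) ≡ x ∷ˢ strip xs
strip-∷ x xs with strip xs
strip-∷ zero xs | [] = refl
strip-∷ (suc x) xs | [] = refl
... | y ∷ ys = refl

strip-∷ˢ : ∀ x s → strip s ≡ s → strip (x ∷ˢ s) ≡ x ∷ˢ s
strip-∷ˢ zero [] _ = refl
strip-∷ˢ (suc x) [] _ = refl
strip-∷ˢ x (y ∷ ys) eq rewrite strip-∷ x (y ∷ ys) | eq = refl

∷ˢ-invariant : ∀ {A : Set} (φ : List ℕ → A) → φ [] ≡ φ (0 ∷ []) → ∀ x s → φ (x ∷ˢ s) ≡ φ (x ∷ s)
∷ˢ-invariant φ φ[]≡φ[0] zero [] = φ[]≡φ[0]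
∷ˢ-invariant φ _ (suc x) [] = refl
∷ˢ-invariant φ _ x (_ ∷ _) = refl

strip-idem : ∀ xs → strip (strip xs) ≡ strip xs
strip-idem [] = refl
strip-idem (x ∷ xs) rewrite strip-∷ x xs = strip-∷ˢ x (strip xs) (strip-idem xs)

length-strip : ∀ L → length (strip L) ≤ length L
length-strip [] = z≤n
length-strip (x ∷ xs) rewrite strip-∷ x xs = go x (strip xs) (length-strip xs)
  where
  go : ∀ {k} x s → length s ≤ k → length (x ∷ˢ s) ≤ suc k
  go x (_ ∷ _) s≤k = s≤s s≤k
  go zero [] _ = z≤n
  go (suc x) [] _ = s≤s z≤n

strip-standard : ∀ {ν} → StandardComposition ν → strip ν ≡ ν
strip-standard [] = refl
strip-standard {suc x ∷ xs} (_ ∷ st) rewrite strip-∷ (suc x) xs | strip-standard st = go xs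
  where
  go : ∀ s → suc x ∷ˢ s ≡ suc x ∷ s
  go [] = refl
  go (_ ∷ _) = refl

exponentAt : ℕ → List ℕ → ℕ
exponentAt j [] = 0
exponentAt zero (c ∷ _) = c
exponentAt (suc j) (_ ∷ m) = exponentAt j m

lowerAt : ℕ → List ℕ → List ℕ
lowerAt j [] = []
lowerAt zero (c ∷ m) = (c ∸ 1) ∷ m
lowerAt (suc j) (c ∷ m) = c ∷ lowerAt j m

exponentAt-strip : ∀ j m → exponentAt j (strip m) ≡ exponentAt j m
exponentAt-strip j [] = refl
exponentAt-strip j (x ∷ xs) rewrite strip-∷ x xs =
  trans (∷ˢ-invariant (exponentAt j) (zero-case j) x (strip xs)) (tail-case j)
  where
  zero-case : ∀ j → exponentAt j [] ≡ exponentAt j (0 ∷ [])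
  zero-case zero = refl
  zero-case (suc j) = refl
  tail-case : ∀ j → exponentAt j (x ∷ strip xs) ≡ exponentAt j (x ∷ xs)
  tail-case zero = refl
  tail-case (suc j) = exponentAt-strip j xs

lowerAt-strip : ∀ j m → strip (lowerAt j (strip m)) ≡ strip (lowerAt j m)
lowerAt-strip j [] = refl
lowerAt-strip j (x ∷ xs) rewrite strip-∷ x xs =
  trans (∷ˢ-invariant (strip ∘ lowerAt j) (zero-case j) x (strip xs)) (tail-case j)
  where
  zero-case : ∀ j → strip (lowerAt j []) ≡ strip (lowerAt j (0 ∷ []))
  zero-case zero = refl
  zero-case (suc j) = refl
  tail-case : ∀ j → strip (lowerAt j (x ∷ strip xs)) ≡ strip (lowerAt j (x ∷ xs))
  tail-case zero rewrite strip-∷ (x ∸ 1) (strip xs) | strip-∷ (x ∸ 1) xs | strip-idem xs = refl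
  tail-case (suc j) rewrite strip-∷ x (lowerAt j (strip xs)) | strip-∷ x (lowerAt j xs) | lowerAt-strip j xs = refl

unit : ℕ → List ℕ
unit j = replicate j 0 ++ 1 ∷ []

isZero : List ℕ → Bool
isZero [] = true
isZero (zero ∷ r) = isZero r
isZero (suc _ ∷ _) = false

isUnit : ℕ → List ℕ → Bool
isUnit j [] = false
isUnit zero (suc zero ∷ r) = isZero r
isUnit zero (_ ∷ _) = false
isUnit (suc j) (zero ∷ r) = isUnit j r
isUnit (suc j) (suc _ ∷ _) = false

∷ˢ-empty : ∀ x s → x ∷ˢ s ≡ [] → x ≡ 0 × s ≡ []
∷ˢ-empty zero [] _ = refl , refl

∷ˢ-nonempty : ∀ {y t} x s → x ∷ˢ s ≡ y ∷ t → x ∷ s ≡ y ∷ t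
∷ˢ-nonempty (suc x) [] eq = eq
∷ˢ-nonempty x (_ ∷ _) eq = eq

0∷ˢunit : ∀ j → 0 ∷ˢ unit j ≡ 0 ∷ unit j
0∷ˢunit zero = refl
0∷ˢunit (suc j) = refl

isZero-sound : ∀ r → isZero r ≡ true → strip r ≡ []
isZero-sound [] _ = refl
isZero-sound (zero ∷ r) h rewrite strip-∷ 0 r | isZero-sound r h = refl

isZero-complete : ∀ r → strip r ≡ [] → isZero r ≡ true
isZero-complete [] _ = refl
isZero-complete (x ∷ r) h with ∷ˢ-empty x (strip r) (trans (sym (strip-∷ x r)) h)
... | refl , hr = isZero-complete r hr

isUnit-sound : ∀ j a → isUnit j a ≡ true → strip a ≡ unit j
isUnit-sound zero (suc zero ∷ r) h rewrite strip-∷ 1 r | isZero-sound r h = refl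
isUnit-sound (suc j) (zero ∷ r) h rewrite strip-∷ 0 r | isUnit-sound j r h = 0∷ˢunit j

isUnit-complete : ∀ j a → strip a ≡ unit j → isUnit j a ≡ true
isUnit-complete zero (x ∷ r) h with ∷-injective (∷ˢ-nonempty x (strip r) (trans (sym (strip-∷ x r)) h))
... | refl , hr = isZero-complete r hr
isUnit-complete (suc j) (x ∷ r) h with ∷-injective (∷ˢ-nonempty x (strip r) (trans (sym (strip-∷ x r)) h))
... | refl , hr = isUnit-complete j r hr

∑ : {A : Set} → (A → ℚ) → List A → ℚ
∑ f xs = sumℚ (map f xs)

∑< : ℕ → (ℕ → ℚ) → ℚ
∑< zero g = 0ℚ
∑< (suc n) g = g 0 + ∑< n (g ∘ suc)

module _ {A : Set} where

  ∑-cong : {f g : A → ℚ} → (∀ x → f x ≡ g x) → ∀ xs → ∑ f xs ≡ ∑ g xs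
  ∑-cong h [] = refl
  ∑-cong h (x ∷ xs) = cong₂ _+_ (h x) (∑-cong h xs)

  ∑-zero : {f : A → ℚ} → (∀ x → f x ≡ 0ℚ) → ∀ xs → ∑ f xs ≡ 0ℚ
  ∑-zero h [] = refl
  ∑-zero h (x ∷ xs) rewrite h x | ∑-zero h xs = refl

  ∑-++ : (f : A → ℚ) → ∀ xs ys → ∑ f (xs ++ ys) ≡ ∑ f xs + ∑ f ys
  ∑-++ f [] ys = sym (ℚ.+-identityˡ _)
  ∑-++ f (x ∷ xs) ys rewrite ∑-++ f xs ys = sym (ℚ.+-assoc (f x) _ _)

  ∑-+ : (f g : A → ℚ) → ∀ xs → ∑ (λ a → f a + g a) xs ≡ ∑ f xs + ∑ g xs
  ∑-+ f g [] = refl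
  ∑-+ f g (x ∷ xs) rewrite ∑-+ f g xs = interchange (f x) (g x) (∑ f xs) (∑ g xs)

  ∑-neg : (f : A → ℚ) → ∀ xs → ∑ (λ a → - f a) xs ≡ - ∑ f xs
  ∑-neg f [] = refl
  ∑-neg f (x ∷ xs) rewrite ∑-neg f xs = sym (ℚ.neg-distrib-+ (f x) (∑ f xs))

  ∑-map : {B : Set} (f : B → ℚ) (g : A → B) → ∀ xs → ∑ f (map g xs) ≡ ∑ (f ∘ g) xs
  ∑-map f g [] = refl
  ∑-map f g (x ∷ xs) = cong (f (g x) +_) (∑-map f g xs)

∑<-cong : ∀ n {f g : ℕ → ℚ} → (∀ i → i < n → f i ≡ g i) → ∑< n f ≡ ∑< n g
∑<-cong zero h = refl
∑<-cong (suc n) h = cong₂ _+_ (h 0 (s≤s z≤n)) (∑<-cong n (λ i i<n → h (suc i) (s≤s i<n)))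

∑<-zero : ∀ n {f : ℕ → ℚ} → (∀ i → f i ≡ 0ℚ) → ∑< n f ≡ 0ℚ
∑<-zero zero h = refl
∑<-zero (suc n) h rewrite h 0 | ∑<-zero n (h ∘ suc) = refl

∑<-snoc : ∀ n g → ∑< (suc n) g ≡ ∑< n g + g n
∑<-snoc zero g = trans (ℚ.+-identityʳ (g 0)) (sym (ℚ.+-identityˡ (g 0)))
∑<-snoc (suc n) g = trans (cong (g 0 +_) (∑<-snoc n (g ∘ suc))) (sym (ℚ.+-assoc (g 0) _ (g (suc n))))

∑-below-∷ : ∀ c m (F : List ℕ → ℚ) →
  ∑ F (below (c ∷ m)) ≡ ∑< (suc c) (λ i → ∑ (λ a → F (i ∷ a)) (below m))
∑-below-∷ c m F = go (suc c) (λ i → i)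
  where
  go : ∀ n f → ∑ F (concatMap (λ i → map (i ∷_) (below m)) (applyUpTo f n))
                ≡ ∑< n (λ i → ∑ (λ a → F (f i ∷ a)) (below m))
  go zero f = refl
  go (suc n) f = trans (∑-++ F (map (f 0 ∷_) (below m)) _) (cong₂ _+_ (∑-map F (f 0 ∷_) (below m)) (go n (f ∘ suc)))

∑-0* : ∀ {A : Set} (g : A → ℚ) xs → ∑ (λ a → 0ℚ * g a) xs ≡ 0ℚ
∑-0* g = ∑-zero (λ a → ℚ.*-zeroˡ (g a))

∑<-∑-0* : ∀ n (g : ℕ → List ℕ → ℚ) xs → ∑< n (λ i → ∑ (λ a → 0ℚ * g i a) xs) ≡ 0ℚ
∑<-∑-0* n g xs = ∑<-zero n (λ i → ∑-0* (g i) xs)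

whenPos : ℕ → ℚ → ℚ
whenPos zero _ = 0ℚ
whenPos (suc _) q = q

zeroCoeff : List ℕ → ℚ
zeroCoeff a = if isZero a then 1ℚ else 0ℚ

unitCoeff : ℕ → List ℕ → ℚ
unitCoeff j a = if isUnit j a then 1ℚ else 0ℚ

∑-below-zeroCoeff : ∀ y (H : List ℕ → ℚ) → ∑ (λ a → zeroCoeff a * H (y ⊝ a)) (below y) ≡ H y
∑-below-zeroCoeff [] H = trans (ℚ.+-identityʳ _) (ℚ.*-identityˡ _)
∑-below-zeroCoeff (c ∷ y) H = begin
  ∑ (λ a → zeroCoeff a * H ((c ∷ y) ⊝ a)) (below (c ∷ y))
    ≡⟨ ∑-below-∷ c y _ ⟩
  ∑ (λ a → zeroCoeff a * H (c ∷ y ⊝ a)) (below y)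
    + ∑< c (λ i → ∑ (λ a → 0ℚ * H (c ∸ suc i ∷ y ⊝ a)) (below y))
    ≡⟨ cong₂ _+_ (∑-below-zeroCoeff y (λ z → H (c ∷ z)))
                 (∑<-∑-0* c (λ i a → H (c ∸ suc i ∷ y ⊝ a)) (below y)) ⟩
  H (c ∷ y) + 0ℚ
    ≡⟨ ℚ.+-identityʳ _ ⟩
  H (c ∷ y)
    ∎
  where open ≡-Reasoning

∑-below-unitCoeff : ∀ j y (H : List ℕ → ℚ) →
  ∑ (λ a → unitCoeff j a * H (y ⊝ a)) (below y) ≡ whenPos (exponentAt j y) (H (lowerAt j y))
∑-below-unitCoeff j [] H = trans (ℚ.+-identityʳ _) (ℚ.*-zeroˡ (H []))
∑-below-unitCoeff (suc j) (c ∷ y) H = begin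
  ∑ (λ a → unitCoeff (suc j) a * H ((c ∷ y) ⊝ a)) (below (c ∷ y))
    ≡⟨ ∑-below-∷ c y _ ⟩
  ∑ (λ a → unitCoeff j a * H (c ∷ y ⊝ a)) (below y)
    + ∑< c (λ i → ∑ (λ a → 0ℚ * H (c ∸ suc i ∷ y ⊝ a)) (below y))
    ≡⟨ cong₂ _+_ (∑-below-unitCoeff j y (λ z → H (c ∷ z)))
                 (∑<-∑-0* c (λ i a → H (c ∸ suc i ∷ y ⊝ a)) (below y)) ⟩
  whenPos (exponentAt j y) (H (c ∷ lowerAt j y)) + 0ℚ
    ≡⟨ ℚ.+-identityʳ _ ⟩
  whenPos (exponentAt j y) (H (c ∷ lowerAt j y))
    ∎
  where open ≡-Reasoning
∑-below-unitCoeff zero (zero ∷ y) H =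
  trans (∑-below-∷ 0 y _) (trans (ℚ.+-identityʳ _) (∑-0* (λ a → H (0 ∷ y ⊝ a)) (below y)))
∑-below-unitCoeff zero (suc c ∷ y) H = begin
  ∑ (λ a → unitCoeff 0 a * H ((suc c ∷ y) ⊝ a)) (below (suc c ∷ y))
    ≡⟨ ∑-below-∷ (suc c) y _ ⟩
  ∑ (λ a → 0ℚ * H (suc c ∷ y ⊝ a)) (below y)
    + (∑ (λ a → zeroCoeff a * H (c ∷ y ⊝ a)) (below y)
       + ∑< c (λ i → ∑ (λ a → 0ℚ * H (c ∸ suc i ∷ y ⊝ a)) (below y)))
    ≡⟨ cong₂ _+_ (∑-0* (λ a → H (suc c ∷ y ⊝ a)) (below y))
                 (cong₂ _+_ (∑-below-zeroCoeff y (λ z → H (c ∷ z)))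
                            (∑<-∑-0* c (λ i a → H (c ∸ suc i ∷ y ⊝ a)) (below y))) ⟩
  0ℚ + (H (c ∷ y) + 0ℚ)
    ≡⟨ trans (ℚ.+-identityˡ _) (ℚ.+-identityʳ _) ⟩
  H (c ∷ y)
    ∎
  where open ≡-Reasoning

varX-strip : ∀ j a → varX (suc j) (strip a) ≡ unitCoeff j a
varX-strip j a with ≡-dec ℕ._≟_ (strip (strip a)) (unit j)
... | yes p rewrite isUnit-complete j a (trans (sym (strip-idem a)) p) = refl
... | no ¬p with isUnit j a in eq
...   | true = ⊥-elim (¬p (trans (strip-idem a) (isUnit-sound j a eq)))
...   | false = refl

varX-⊗ : ∀ j (h : Series) y → (varX (suc j) ⊗ h) (strip y) ≡ whenPos (exponentAt j y) (h (strip (lowerAt j y)))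
varX-⊗ j h y = begin
  ∑ (λ a → varX (suc j) (strip a) * h (strip (strip y ⊝ a))) (below (strip y))
    ≡⟨ ∑-cong (λ a → cong (_* h (strip (strip y ⊝ a))) (varX-strip j a)) (below (strip y)) ⟩
  ∑ (λ a → unitCoeff j a * h (strip (strip y ⊝ a))) (below (strip y))
    ≡⟨ ∑-below-unitCoeff j (strip y) (h ∘ strip) ⟩
  whenPos (exponentAt j (strip y)) (h (strip (lowerAt j (strip y))))
    ≡⟨ cong₂ whenPos (exponentAt-strip j y) (cong h (lowerAt-strip j y)) ⟩
  whenPos (exponentAt j y) (h (strip (lowerAt j y)))
    ∎
  where open ≡-Reasoning

whenPos-∸ : ∀ {i c} → i < c → (φ : ℕ → ℚ) → whenPos (c ∸ i) (φ (c ∸ i ∸ 1)) ≡ φ (c ∸ suc i)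
whenPos-∸ {zero} {suc c} _ φ = refl
whenPos-∸ {suc i} {suc c} (s≤s i<c) φ = whenPos-∸ i<c φ

whenPos-n∸n : ∀ c q → whenPos (c ∸ c) q ≡ 0ℚ
whenPos-n∸n c q rewrite ℕ.n∸n≡0 c = refl

-- Both sides are the sum over a ≤ m with a_j > 0 of R (a − e_j) · H (m − a), the left one
-- after substituting a ↦ a + e_j.
∑-below-shift : ∀ j m (R H : List ℕ → ℚ) →
  ∑ (λ a → R a * whenPos (exponentAt j (m ⊝ a)) (H (lowerAt j (m ⊝ a)))) (below m) ≡
  ∑ (λ a → whenPos (exponentAt j a) (R (lowerAt j a)) * H (m ⊝ a)) (below m)
∑-below-shift j [] R H = cong (_+ 0ℚ) (trans (ℚ.*-zeroʳ (R [])) (sym (ℚ.*-zeroˡ (H []))))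
∑-below-shift (suc j) (c ∷ m) R H =
  trans (∑-below-∷ c m _)
    (trans (∑<-cong (suc c) (λ i _ → ∑-below-shift j m (λ a → R (i ∷ a)) (λ z → H (c ∸ i ∷ z))))
           (sym (∑-below-∷ c m _)))
∑-below-shift zero (c ∷ m) R H = begin
  ∑ (λ a → R a * whenPos (exponentAt 0 ((c ∷ m) ⊝ a)) (H (lowerAt 0 ((c ∷ m) ⊝ a)))) (below (c ∷ m))
    ≡⟨ ∑-below-∷ c m _ ⟩
  ∑< (suc c) f
    ≡⟨ ∑<-snoc c f ⟩
  ∑< c f + f c
    ≡⟨ cong₂ _+_ (∑<-cong c (λ i i<c → ∑-cong (λ a → cong (R (i ∷ a) *_)
                                                         (whenPos-∸ i<c (λ k → H (k ∷ m ⊝ a)))) (below m)))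
                 (∑-zero (λ a → trans (cong (R (c ∷ a) *_) (whenPos-n∸n c _)) (ℚ.*-zeroʳ (R (c ∷ a))))
                         (below m)) ⟩
  ∑< c g + 0ℚ
    ≡⟨ ℚ.+-comm (∑< c g) 0ℚ ⟩
  0ℚ + ∑< c g
    ≡⟨ cong (_+ ∑< c g) (∑-0* (λ a → H (c ∷ m ⊝ a)) (below m)) ⟨
  ∑ (λ a → 0ℚ * H (c ∷ m ⊝ a)) (below m) + ∑< c g
    ≡⟨ ∑-below-∷ c m _ ⟨
  ∑ (λ a → whenPos (exponentAt 0 a) (R (lowerAt 0 a)) * H ((c ∷ m) ⊝ a)) (below (c ∷ m))
    ∎
  where
  open ≡-Reasoning
  f g : ℕ → ℚ
  f i = ∑ (λ a → R (i ∷ a) * whenPos (c ∸ i) (H (c ∸ i ∸ 1 ∷ m ⊝ a))) (below m)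
  g i = ∑ (λ a → R (i ∷ a) * H (c ∸ suc i ∷ m ⊝ a)) (below m)

⊗-varX-swap : ∀ j (r h : Series) m → (r ⊗ (varX (suc j) ⊗ h)) m ≡ ((varX (suc j) ⊗ r) ⊗ h) m
⊗-varX-swap j r h m = begin
  ∑ (λ a → r (strip a) * (varX (suc j) ⊗ h) (strip (m ⊝ a))) (below m)
    ≡⟨ ∑-cong (λ a → cong (r (strip a) *_) (varX-⊗ j h (m ⊝ a))) (below m) ⟩
  ∑ (λ a → r (strip a) * whenPos (exponentAt j (m ⊝ a)) (h (strip (lowerAt j (m ⊝ a))))) (below m)
    ≡⟨ ∑-below-shift j m (r ∘ strip) (h ∘ strip) ⟩
  ∑ (λ a → whenPos (exponentAt j a) (r (strip (lowerAt j a))) * h (strip (m ⊝ a))) (below m)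
    ≡⟨ ∑-cong (λ a → cong (_* h (strip (m ⊝ a))) (sym (varX-⊗ j r a))) (below m) ⟩
  ∑ (λ a → (varX (suc j) ⊗ r) (strip a) * h (strip (m ⊝ a))) (below m)
    ∎
  where open ≡-Reasoning

⊗-distribˡ-⊖ : ∀ (r h₁ h₂ : Series) m → (r ⊗ (h₁ ⊖ h₂)) m ≡ ((r ⊗ h₁) ⊖ (r ⊗ h₂)) m
⊗-distribˡ-⊖ r h₁ h₂ m = begin
  ∑ (λ a → r (strip a) * (h₁ (strip (m ⊝ a)) - h₂ (strip (m ⊝ a)))) (below m)
    ≡⟨ ∑-cong (λ a → trans (ℚ.*-distribˡ-+ (r (strip a)) (h₁ (strip (m ⊝ a))) (- h₂ (strip (m ⊝ a))))
                           (cong (p a +_) (sym (ℚ.neg-distribʳ-* (r (strip a)) (h₂ (strip (m ⊝ a))))))) (below m) ⟩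
  ∑ (λ a → p a + - q a) (below m)      ≡⟨ ∑-+ p (λ a → - q a) (below m) ⟩
  ∑ p (below m) + ∑ (λ a → - q a) (below m)  ≡⟨ cong (∑ p (below m) +_) (∑-neg q (below m)) ⟩
  ∑ p (below m) - ∑ q (below m)        ∎
  where
  open ≡-Reasoning
  p q : List ℕ → ℚ
  p a = r (strip a) * h₁ (strip (m ⊝ a))
  q a = r (strip a) * h₂ (strip (m ⊝ a))

negate : Series → Series
negate f m = - f m

negate-⊗ : ∀ (r h : Series) m → (negate r ⊗ h) m ≡ - (r ⊗ h) m
negate-⊗ r h m =
  trans (∑-cong (λ a → sym (ℚ.neg-distribˡ-* (r (strip a)) (h (strip (m ⊝ a))))) (below m))
        (∑-neg _ (below m))

module _ {I : Set} {P : I → Set} (gen : I → Series) where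

  combination : List (Series × Σ I P) → Series
  combination = foldr (λ t acc → (proj₁ t ⊗ gen (proj₁ (proj₂ t))) ⊕ acc) zeroS

  combination-++ : ∀ ts us m → combination (ts ++ us) m ≡ combination ts m + combination us m
  combination-++ [] us m = sym (ℚ.+-identityˡ _)
  combination-++ ((r , i , _) ∷ ts) us m =
    trans (cong ((r ⊗ gen i) m +_) (combination-++ ts us m))
          (sym (ℚ.+-assoc ((r ⊗ gen i) m) (combination ts m) (combination us m)))

  combination-negate : ∀ ts m → combination (map (λ (r , i) → negate r , i) ts) m ≡ - combination ts m
  combination-negate [] m = refl
  combination-negate ((r , i , _) ∷ ts) m =
    trans (cong₂ _+_ (negate-⊗ r (gen i) m) (combination-negate ts m))
          (sym (ℚ.neg-distrib-+ ((r ⊗ gen i) m) (combination ts m)))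

  InIdeal-resp : ∀ {f g} → f ≈ g → InIdeal P gen f → InIdeal P gen g
  InIdeal-resp f≈g (ts , f≈ts) = ts , λ m → trans (sym (f≈g m)) (f≈ts m)

  InIdeal-zeroS : InIdeal P gen zeroS
  InIdeal-zeroS = [] , λ _ → refl

  InIdeal-⊕ : ∀ {f g} → InIdeal P gen f → InIdeal P gen g → InIdeal P gen (f ⊕ g)
  InIdeal-⊕ (ts , f≈ts) (us , g≈us) =
    ts ++ us , λ m → trans (cong₂ _+_ (f≈ts m) (g≈us m)) (sym (combination-++ ts us (strip m)))

  InIdeal-negate : ∀ {f} → InIdeal P gen f → InIdeal P gen (negate f)
  InIdeal-negate (ts , f≈ts) =
    map (λ (r , i) → negate r , i) ts , λ m → trans (cong -_ (f≈ts m)) (sym (combination-negate ts (strip m)))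

  InIdeal-⊖ : ∀ {f g} → InIdeal P gen f → InIdeal P gen g → InIdeal P gen (f ⊖ g)
  InIdeal-⊖ {f} {g} f∈ g∈ = InIdeal-⊕ {f} {negate g} f∈ (InIdeal-negate {g} g∈)

  InIdeal-generator : ∀ {i} → P i → ∀ r → InIdeal P gen (r ⊗ gen i)
  InIdeal-generator {i} Pi r = ((r , i , Pi) ∷ []) , λ m → sym (ℚ.+-identityʳ _)

  -- Stands in for closure of InIdeal under multiplication, which would need associativity of ⊗.
  MultiplesIn : Series → Set
  MultiplesIn h = ∀ r → InIdeal P gen (r ⊗ h)

  MultiplesIn-⊖ : ∀ {h₁ h₂} → MultiplesIn h₁ → MultiplesIn h₂ → MultiplesIn (h₁ ⊖ h₂)
  MultiplesIn-⊖ {h₁} {h₂} h₁∈ h₂∈ r =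
    InIdeal-resp {(r ⊗ h₁) ⊖ (r ⊗ h₂)} {r ⊗ (h₁ ⊖ h₂)} (λ m → sym (⊗-distribˡ-⊖ r h₁ h₂ (strip m)))
      (InIdeal-⊖ {r ⊗ h₁} {r ⊗ h₂} (h₁∈ r) (h₂∈ r))

  MultiplesIn-varX : ∀ j {h} → MultiplesIn h → MultiplesIn (varX (suc j) ⊗ h)
  MultiplesIn-varX j {h} h∈ r =
    InIdeal-resp {(varX (suc j) ⊗ r) ⊗ h} {r ⊗ (varX (suc j) ⊗ h)} (λ m → sym (⊗-varX-swap j r h (strip m)))
      (h∈ (varX (suc j) ⊗ r))

InIdeal-⊆ : ∀ {I J : Set} {P : I → Set} {Q : J → Set} {gen : I → Series} {gen′ : J → Series} →
  (∀ i → P i → MultiplesIn {P = Q} gen′ (gen i)) → ∀ {f} → InIdeal P gen f → InIdeal Q gen′ f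
InIdeal-⊆ {gen = gen} {gen′} gens∈ {f} (ts , f≈ts) =
  InIdeal-resp gen′ {combination gen ts} {f} (λ m → sym (f≈ts m)) (go ts)
  where
  go : ∀ ts → InIdeal _ gen′ (combination gen ts)
  go [] = InIdeal-zeroS gen′
  go ((r , i , Pi) ∷ ts) = InIdeal-⊕ gen′ {r ⊗ gen i} {combination gen ts} (gens∈ i Pi r) (go ts)

-- L read after an initial segment of length c and sum d; ReachesInf e L is ReachesAfter e 0 0 L.
ReachesAfter : ℕ → ℕ → ℕ → List ℕ → Set
ReachesAfter e c d L = Σ ℕ λ n → (1 ≤ c ℕ.+ n) × (e ℕ.+ (c ℕ.+ n) ≤ d ℕ.+ sum (take n L))

module _ {e : ℕ} where

  ReachesAfter-∷ : ∀ g {L₁ L₂} → (∀ c d → ReachesAfter e c d L₁ → ReachesAfter e c d L₂) →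
                   ∀ c d → ReachesAfter e c d (g ∷ L₁) → ReachesAfter e c d (g ∷ L₂)
  ReachesAfter-∷ g h c d (zero , c≥1 , le) = zero , c≥1 , le
  ReachesAfter-∷ g {L₂ = L₂} h c d (suc n , _ , le) =
    unshift (h (suc c) (d ℕ.+ g) (n , s≤s z≤n , subst₂ _≤_ (cong (e ℕ.+_) (+-suc c n)) (sym (+-assoc d g _)) le))
    where
    unshift : ReachesAfter e (suc c) (d ℕ.+ g) L₂ → ReachesAfter e c d (g ∷ L₂)
    unshift (n′ , _ , le′) =
      suc n′ , ≤-trans (s≤s z≤n) (ℕ.m≤n+m (suc n′) c) ,
      subst₂ _≤_ (cong (e ℕ.+_) (sym (+-suc c n′))) (+-assoc d g _) le′

  ReachesAfter-++ : ∀ γ {L₁ L₂} → (∀ c d → ReachesAfter e c d L₁ → ReachesAfter e c d L₂) →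
                    ∀ c d → ReachesAfter e c d (γ ++ L₁) → ReachesAfter e c d (γ ++ L₂)
  ReachesAfter-++ [] h = h
  ReachesAfter-++ (g ∷ γ) h = ReachesAfter-∷ g (ReachesAfter-++ γ h)

  ReachesAfter-merge : ∀ {a b} β → a ≤ suc b → ∀ c d →
                       ReachesAfter e c d (0 ∷ a ∷ β) → ReachesAfter e c d (b ∷ β)
  ReachesAfter-merge β a≤1+b c d (zero , c≥1 , le) = zero , c≥1 , le
  ReachesAfter-merge β a≤1+b c d (suc zero , c≥1 , le) = 1 , c≥1 , ≤-trans le (+-monoʳ-≤ d z≤n)
  ReachesAfter-merge {a} {b} β a≤1+b c d (suc (suc k) , _ , le) =
    suc k , ≤-trans (s≤s z≤n) (ℕ.m≤n+m (suc k) c) , ≤-pred (begin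
      suc (e ℕ.+ (c ℕ.+ suc k))   ≡⟨ sym (trans (cong (e ℕ.+_) (+-suc c (suc k))) (+-suc e _)) ⟩
      e ℕ.+ (c ℕ.+ suc (suc k))   ≤⟨ le ⟩
      d ℕ.+ (a ℕ.+ S)             ≤⟨ +-monoʳ-≤ d (+-monoˡ-≤ S a≤1+b) ⟩
      d ℕ.+ suc (b ℕ.+ S)         ≡⟨ +-suc d (b ℕ.+ S) ⟩
      suc (d ℕ.+ (b ℕ.+ S))       ∎)
    where
    open ℕ.≤-Reasoning
    S = sum (take k β)

  ReachesAfter-dropLast0 : ∀ c d → ReachesAfter e c d (0 ∷ []) → ReachesAfter e c d []
  ReachesAfter-dropLast0 c d (zero , c≥1 , le) = zero , c≥1 , le
  ReachesAfter-dropLast0 c d (suc k , c≥1 , le) =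
    suc k , c≥1 , subst (λ s → e ℕ.+ (c ℕ.+ suc k) ≤ d ℕ.+ sum s) (take-[] k) le

  ReachesInf-merge : ∀ γ {a b} β → a ≤ suc b → ReachesInf e (γ ++ 0 ∷ a ∷ β) → ReachesInf e (γ ++ b ∷ β)
  ReachesInf-merge γ β a≤1+b = ReachesAfter-++ γ (ReachesAfter-merge β a≤1+b) 0 0

  ReachesInf-dropLast0 : ∀ γ → ReachesInf e (γ ++ 0 ∷ []) → ReachesInf e γ
  ReachesInf-dropLast0 γ r = subst (ReachesInf e) (++-identityʳ γ) (ReachesAfter-++ γ ReachesAfter-dropLast0 0 0 r)

  ¬ReachesInf-[] : ¬ ReachesInf e []
  ¬ReachesInf-[] (n , n≥1 , le)
    with () ← ≤-trans n≥1 (≤-trans (ℕ.m≤n+m n e) (subst (e ℕ.+ n ≤_) (cong sum (take-[] n)) le))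

  ReachesInf⇒ReachesStd : ∀ ν → ReachesInf e ν → ReachesStd e ν
  ReachesInf⇒ReachesStd [] r = ⊥-elim (¬ReachesInf-[] r)
  ReachesInf⇒ReachesStd ν@(_ ∷ _) (n , n≥1 , le) with n ≤? length ν
  ... | yes n≤ℓ = n , n≥1 , n≤ℓ , le
  ... | no n≰ℓ = length ν , s≤s z≤n , ≤-refl , (begin
    e ℕ.+ length ν            ≤⟨ +-monoʳ-≤ e ℓ≤n ⟩
    e ℕ.+ n                   ≤⟨ le ⟩
    sum (take n ν)            ≡⟨ cong sum (take-all n ν ℓ≤n) ⟩
    sum ν                     ≡⟨ cong sum (take-all (length ν) ν ≤-refl) ⟨
    sum (take (length ν) ν)   ∎)
    where
    open ℕ.≤-Reasoning
    ℓ≤n = ℕ.<⇒≤ (ℕ.≰⇒> n≰ℓ)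

sum-take-strip : ∀ n L → sum (take n (strip L)) ≡ sum (take n L)
sum-take-strip n [] = refl
sum-take-strip n (x ∷ xs) rewrite strip-∷ x xs =
  trans (∷ˢ-invariant (sum ∘ take n) (zero-case n) x (strip xs)) (tail-case n)
  where
  zero-case : ∀ n → sum (take n []) ≡ sum (take n (0 ∷ []))
  zero-case zero = refl
  zero-case (suc n) = cong sum (sym (take-[] n))
  tail-case : ∀ n → sum (take n (x ∷ strip xs)) ≡ sum (take n (x ∷ xs))
  tail-case zero = refl
  tail-case (suc n) = cong (x ℕ.+_) (sum-take-strip n xs)

ReachesInf-strip : ∀ {e} L → ReachesInf e L → ReachesInf e (strip L)
ReachesInf-strip {e} L (n , n≥1 , le) = n , n≥1 , subst (e ℕ.+ n ≤_) (sym (sum-take-strip n L)) le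

splitLastZero-just : ∀ ν {γ r} → splitLastZero ν ≡ just (γ , r) → ν ≡ γ ++ 0 ∷ r
splitLastZero-just (x ∷ xs) eq with splitLastZero xs in eq′
splitLastZero-just (x ∷ xs) refl | just _ = cong (x ∷_) (splitLastZero-just xs eq′)
splitLastZero-just (zero ∷ xs) refl | nothing = refl

splitLastZero-nothing : ∀ ν → splitLastZero ν ≡ nothing → StandardComposition ν
splitLastZero-nothing [] _ = []
splitLastZero-nothing (x ∷ xs) eq with splitLastZero xs in eq′
splitLastZero-nothing (suc x ∷ xs) refl | nothing = s≤s z≤n ∷ splitLastZero-nothing xs eq′

splitLastZero-standard : ∀ {ν} → StandardComposition ν → splitLastZero ν ≡ nothing
splitLastZero-standard [] = refl
splitLastZero-standard {suc x ∷ xs} (_ ∷ st) rewrite splitLastZero-standard st = refl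

Gfuel-standard : ∀ n {ν} → StandardComposition ν → Gfuel n ν ≡ F ν
Gfuel-standard zero st = refl
Gfuel-standard (suc n) st rewrite splitLastZero-standard st = refl

G-standard : ∀ {α} → StandardComposition α → G α ≡ F α
G-standard {α} st rewrite strip-standard st = Gfuel-standard (length α) st

length-∷-∷ : ∀ γ (x y z : ℕ) β → length (γ ++ x ∷ y ∷ β) ≡ suc (length (γ ++ z ∷ β))
length-∷-∷ γ x y z β = trans (length-++ γ) (trans (+-suc (length γ) _) (cong suc (sym (length-++ γ))))

IsJGenerator : ℕ → List ℕ → Set
IsJGenerator e α = StandardComposition α × ReachesStd e α

Gstrip-multiplesIn-J : ∀ {e} n L → length L ≤ n → ReachesInf e L →
                       MultiplesIn {P = IsJGenerator e} F (Gfuel n (strip L))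

Gfuel-multiplesIn-J : ∀ {e} n ν → length ν ≤ n → ReachesInf e ν →
                      MultiplesIn {P = IsJGenerator e} F (Gfuel n ν)
Gfuel-multiplesIn-J zero [] _ r = ⊥-elim (¬ReachesInf-[] r)
Gfuel-multiplesIn-J {e} (suc n) ν ℓ≤1+n r with splitLastZero ν in eq
... | nothing = InIdeal-generator F (splitLastZero-nothing ν eq , ReachesInf⇒ReachesStd ν r)
... | just (γ , []) with refl ← splitLastZero-just ν eq =
  -- unreachable for stripped ν, but simpler to handle than to exclude
  Gstrip-multiplesIn-J n γ (≤-pred (subst (_≤ suc n) (trans (length-++ γ) (ℕ.+-comm (length γ) 1)) ℓ≤1+n))
    (ReachesInf-dropLast0 γ r)
... | just (γ , a ∷ β) with refl ← splitLastZero-just ν eq =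
  subst (λ k → MultiplesIn {P = IsJGenerator e} F (G₁ ⊖ (varX k ⊗ G₂))) (ℕ.+-comm 1 (length γ))
        (MultiplesIn-⊖ F {G₁} {varX (suc (length γ)) ⊗ G₂} (merged a (ℕ.n≤1+n a))
          (MultiplesIn-varX F (length γ) {G₂} (merged (a ∸ 1) (ℕ.m≤n+m∸n a 1))))
  where
  G₁ = Gfuel n (strip (γ ++ a ∷ β))
  G₂ = Gfuel n (strip (γ ++ (a ∸ 1) ∷ β))
  merged : ∀ b → a ≤ suc b → MultiplesIn {P = IsJGenerator e} F (Gfuel n (strip (γ ++ b ∷ β)))
  merged b a≤1+b =
    Gstrip-multiplesIn-J n (γ ++ b ∷ β) (≤-pred (subst (_≤ suc n) (length-∷-∷ γ 0 a b β) ℓ≤1+n))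
                         (ReachesInf-merge γ β a≤1+b r)

Gstrip-multiplesIn-J n L ℓ≤n r =
  Gfuel-multiplesIn-J n (strip L) (≤-trans (length-strip L) ℓ≤n) (ReachesInf-strip L r)

lemma3p2 : (e : ℕ) (f : Series) → (InJ e f → InGIdeal e f) × (InGIdeal e f → InJ e f)
lemma3p2 e f = InIdeal-⊆ {gen = F} {G} F-multiplesIn-G {f} , InIdeal-⊆ {gen = G} {F} G-multiplesIn-J {f}
  where
  F-multiplesIn-G : ∀ α → IsJGenerator e α → MultiplesIn {P = ReachesInf e} G (F α)
  F-multiplesIn-G α (st , n , n≥1 , _ , le) r =
    subst (λ h → InGIdeal e (r ⊗ h)) (G-standard st) (InIdeal-generator G (n , n≥1 , le) r)
  G-multiplesIn-J : ∀ L → ReachesInf e L → MultiplesIn {P = IsJGenerator e} F (G L)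
  G-multiplesIn-J L = Gstrip-multiplesIn-J (length L) L ≤-refl
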